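{- (Hauptsatz / cut-elimination for $\mathrm{ML}_{\mathcal P}$.) Let $\mathcal P$ be any set of formulas. Every $\mathcal P$-sequent $\Gamma \vdash \Delta;\Pi$ that is derivable in $\mathrm{ML}_{\mathcal P}$ has a derivation in $\mathrm{ML}_{\mathcal P}$ that uses neither of the rules $cut_1$, $cut_2$.
   Context: Formulas are given by the grammar $F ::= 0 \mid \perp \mid X \mid F\wedge F \mid F\vee F \mid F\rightarrow F$, where $X$ ranges over a set $\mathcal V$ of propositional variables and $0$, $\perp$ are two distinct constants. Fix an arbitrary set $\mathcal P$ of formulas. A $\mathcal P$-sequent is an expression $\Gamma\vdash\Delta;\Pi$ where $\Gamma,\Delta,\Pi$ are finite multisets of formulas, every formula of $\Delta$ (the body) belongs to $\mathcal P$, and $\Pi$ (the stoup) contains at most one formula. The system $\mathrm{ML}_{\mathcal P}$ derives $\mathcal P$-sequents with the following rules (below $C$ denotes a single formula, $\Pi$ a stoup with at most one formula, and all sequents must be $\mathcal P$-sequents): Axiom/cuts: $ax$: $A\vdash ;A$. $cut_1$: from $\Gamma\vdash\Delta;A$ and $\Gamma',A\vdash\Delta';\Pi$ infer $\Gamma,\Gamma'\vdash\Delta,\Delta';\Pi$. $cut_2$: from $\Gamma\vdash\Delta,A;\Pi$ and $\Gamma',A\vdash\Delta';$ infer $\Gamma,\Gamma'\vdash\Delta,\Delta';\Pi$. Structure: $der$: from $\Gamma\vdash\Delta;A$ with $A\in\mathcal P$ infer $\Gamma\vdash\Delta,A;$. $c_l$: from $\Gamma,A,A\vdash\Delta;\Pi$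 infer $\Gamma,A\vdash\Delta;\Pi$. $c_r$: from $\Gamma\vdash\Delta,A,A;\Pi$ infer $\Gamma\vdash\Delta,A;\Pi$. $w_l$: from $\Gamma\vdash\Delta;\Pi$ infer $\Gamma,A\vdash\Delta;\Pi$. $w_r$: from $\Gamma\vdash\Delta;\Pi$ with $A\in\mathcal P$ infer $\Gamma\vdash\Delta,A;\Pi$. Logic: $0$: $\Gamma,0\vdash\Delta;\Pi$ (any $\Delta\subseteq\mathcal P$). $\perp$: $\perp\vdash ;$. $\wedge^1_l$: from $\Gamma,A,B\vdash\Delta;C$ with $A\notin\mathcal P$ and $B\notin\mathcal P$ infer $\Gamma,A\wedge B\vdash\Delta;C$. $\wedge^2_l$: from $\Gamma,A,B\vdash\Delta;$ infer $\Gamma,A\wedge B\vdash\Delta;$. $\wedge^1_r$: from $\Gamma\vdash\Delta;A$ and $\Gamma'\vdash\Delta';B$ infer $\Gamma,\Gamma'\vdash\Delta,\Delta';A\wedge B$. $\wedge^2_r$: from $\Gamma\vdash\Delta,A;$ and $\Gamma'\vdash\Delta',B;$ infer the same conclusion. $\wedge^3_r$: from $\Gamma\vdash\Delta;A$ and $\Gamma'\vdash\Delta',B;$ infer the same conclusion. $\wedge^4_r$: from $\Gamma\vdash\Delta,A;$ and $\Gamma'\vdash\Delta';B$ infer the same conclusion. $\vee^1_l$: from $\Gamma,A\vdash\Delta;C$ and $\Gamma,B\vdash\Delta;C$ with $A\notin\mathcal P$ and $B\notin\mathcal P$ infer $\Gamma,A\vee B\vdash\Delta;C$. $\vee^2_l$: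 from $\Gamma,A\vdash\Delta;$ and $\Gamma,B\vdash\Delta;$ infer $\Gamma,A\vee B\vdash\Delta;$. $\vee^1_r$: from $\Gamma\vdash\Delta;A$ infer $\Gamma\vdash\Delta;A\vee B$. $\vee^2_r$: from $\Gamma\vdash\Delta;B$ infer $\Gamma\vdash\Delta;A\vee B$. $\vee^3_r$: from $\Gamma\vdash\Delta,A;$ infer $\Gamma\vdash\Delta;A\vee B$. $\vee^4_r$: from $\Gamma\vdash\Delta,B;$ infer $\Gamma\vdash\Delta;A\vee B$. $\rightarrow^1_l$: from $\Gamma,B\vdash\Delta;C$ and $\Gamma'\vdash\Delta';A$ with $B\notin\mathcal P$ infer $\Gamma,\Gamma',A\rightarrow B\vdash\Delta,\Delta';C$. $\rightarrow^2_l$: from $\Gamma,B\vdash\Delta;$ and $\Gamma'\vdash\Delta';A$ infer $\Gamma,\Gamma',A\rightarrow B\vdash\Delta,\Delta';$. $\rightarrow^3_l$: from $\Gamma,B\vdash\Delta;$ and $\Gamma'\vdash\Delta',A;\Pi$ infer $\Gamma,\Gamma',A\rightarrow B\vdash\Delta,\Delta';\Pi$. $\rightarrow^1_r$: from $\Gamma,A\vdash\Delta;B$ infer $\Gamma\vdash\Delta;A\rightarrow B$. $\rightarrow^2_r$: from $\Gamma,A\vdash\Delta,B;$ infer $\Gamma\vdash\Delta;A\rightarrow B$. One writes $\Gamma\vdash_{\mathcal P}\Delta;\Pi$ when the $\mathcal P$-sequent $\Gamma\vdash\Delta;\Pi$ is derivable in $\mathrm{ML}_{\mathcal P}$. -}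

module Defs where

open import Data.Bool using (Bool; true; false)
open import Data.List using (List; []; _∷_; _++_; [_])
open import Data.List.Relation.Unary.All using (All)
open import Data.List.Relation.Binary.Permutation.Propositional using (_↭_)
open import Data.Maybe using (Maybe; just; nothing)
open import Relation.Nullary using (¬_)
open import Relation.Binary.PropositionalEquality using (_≡_)

data Formula (V : Set) : Set where
  𝟎    : Formula V
  ⊥'   : Formula V
  var  : V → Formula V
  _∧_  : Formula V → Formula V → Formula V
  _∨_  : Formula V → Formula V → Formula V
  _⇒_  : Formula V → Formula V → Formula V

-- Multisets are represented by lists; the rule `ex` closes derivability under
-- permutation of antecedent and body, so derivability is a property of multisets.
-- The stoup (at most one formula) is a Maybe.
-- `Der P c Γ Δ Π` : derivations of the P-sequent Γ ⊢ Δ ; Π in ML_P;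
-- the cut rules are only available when c ≡ true.
data Der {V : Set} (P : Formula V → Set) (c : Bool) :
         List (Formula V) → List (Formula V) → Maybe (Formula V) → Set where
  ex   : ∀ {Γ Γ' Δ Δ' Π} → Γ ↭ Γ' → Δ ↭ Δ' → Der P c Γ Δ Π → Der P c Γ' Δ' Π
  ax   : ∀ {A} → Der P c [ A ] [] (just A)
  cut₁ : ∀ {Γ Γ' Δ Δ' Π A} → c ≡ true →
         Der P c Γ Δ (just A) → Der P c (A ∷ Γ') Δ' Π → Der P c (Γ ++ Γ') (Δ ++ Δ') Π
  cut₂ : ∀ {Γ Γ' Δ Δ' Π A} → c ≡ true →
         Der P c Γ (A ∷ Δ) Π → Der P c (A ∷ Γ') Δ' nothing → Der P c (Γ ++ Γ') (Δ ++ Δ') Π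
  der  : ∀ {Γ Δ A} → P A → Der P c Γ Δ (just A) → Der P c Γ (A ∷ Δ) nothing
  cₗ   : ∀ {Γ Δ Π A} → Der P c (A ∷ A ∷ Γ) Δ Π → Der P c (A ∷ Γ) Δ Π
  cᵣ   : ∀ {Γ Δ Π A} → Der P c Γ (A ∷ A ∷ Δ) Π → Der P c Γ (A ∷ Δ) Π
  wₗ   : ∀ {Γ Δ Π A} → Der P c Γ Δ Π → Der P c (A ∷ Γ) Δ Π
  wᵣ   : ∀ {Γ Δ Π A} → P A → Der P c Γ Δ Π → Der P c Γ (A ∷ Δ) Π
  zero : ∀ {Γ Δ Π} → All P Δ → Der P c (𝟎 ∷ Γ) Δ Π
  bot  : Der P c [ ⊥' ] [] nothing
  ∧ₗ¹  : ∀ {Γ Δ A B C} → ¬ P A → ¬ P B →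
         Der P c (A ∷ B ∷ Γ) Δ (just C) → Der P c ((A ∧ B) ∷ Γ) Δ (just C)
  ∧ₗ²  : ∀ {Γ Δ A B} → Der P c (A ∷ B ∷ Γ) Δ nothing → Der P c ((A ∧ B) ∷ Γ) Δ nothing
  ∧ᵣ¹  : ∀ {Γ Γ' Δ Δ' A B} → Der P c Γ Δ (just A) → Der P c Γ' Δ' (just B) →
         Der P c (Γ ++ Γ') (Δ ++ Δ') (just (A ∧ B))
  ∧ᵣ²  : ∀ {Γ Γ' Δ Δ' A B} → Der P c Γ (A ∷ Δ) nothing → Der P c Γ' (B ∷ Δ') nothing →
         Der P c (Γ ++ Γ') (Δ ++ Δ') (just (A ∧ B))
  ∧ᵣ³  : ∀ {Γ Γ' Δ Δ' A B} → Der P c Γ Δ (just A) → Der P c Γ' (B ∷ Δ') nothing →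
         Der P c (Γ ++ Γ') (Δ ++ Δ') (just (A ∧ B))
  ∧ᵣ⁴  : ∀ {Γ Γ' Δ Δ' A B} → Der P c Γ (A ∷ Δ) nothing → Der P c Γ' Δ' (just B) →
         Der P c (Γ ++ Γ') (Δ ++ Δ') (just (A ∧ B))
  ∨ₗ¹  : ∀ {Γ Δ A B C} → ¬ P A → ¬ P B →
         Der P c (A ∷ Γ) Δ (just C) → Der P c (B ∷ Γ) Δ (just C) →
         Der P c ((A ∨ B) ∷ Γ) Δ (just C)
  ∨ₗ²  : ∀ {Γ Δ A B} → Der P c (A ∷ Γ) Δ nothing → Der P c (B ∷ Γ) Δ nothing →
         Der P c ((A ∨ B) ∷ Γ) Δ nothing
  ∨ᵣ¹  : ∀ {Γ Δ A B} → Der P c Γ Δ (just A) → Der P c Γ Δ (just (A ∨ B))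
  ∨ᵣ²  : ∀ {Γ Δ A B} → Der P c Γ Δ (just B) → Der P c Γ Δ (just (A ∨ B))
  ∨ᵣ³  : ∀ {Γ Δ A B} → Der P c Γ (A ∷ Δ) nothing → Der P c Γ Δ (just (A ∨ B))
  ∨ᵣ⁴  : ∀ {Γ Δ A B} → Der P c Γ (B ∷ Δ) nothing → Der P c Γ Δ (just (A ∨ B))
  ⇒ₗ¹  : ∀ {Γ Γ' Δ Δ' A B C} → ¬ P B →
         Der P c (B ∷ Γ) Δ (just C) → Der P c Γ' Δ' (just A) →
         Der P c ((A ⇒ B) ∷ (Γ ++ Γ')) (Δ ++ Δ') (just C)
  ⇒ₗ²  : ∀ {Γ Γ' Δ Δ' A B} →
         Der P c (B ∷ Γ) Δ nothing → Der P c Γ' Δ' (just A) →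
         Der P c ((A ⇒ B) ∷ (Γ ++ Γ')) (Δ ++ Δ') nothing
  ⇒ₗ³  : ∀ {Γ Γ' Δ Δ' A B Π} →
         Der P c (B ∷ Γ) Δ nothing → Der P c Γ' (A ∷ Δ') Π →
         Der P c ((A ⇒ B) ∷ (Γ ++ Γ')) (Δ ++ Δ') Π
  ⇒ᵣ¹  : ∀ {Γ Δ A B} → Der P c (A ∷ Γ) Δ (just B) → Der P c Γ Δ (just (A ⇒ B))
  ⇒ᵣ²  : ∀ {Γ Δ A B} → Der P c (A ∷ Γ) (B ∷ Δ) nothing → Der P c Γ Δ (just (A ⇒ B))

Derivable : ∀ {V} → (Formula V → Set) → List (Formula V) → List (Formula V) → Maybe (Formula V) → Set
Derivable P = Der P true

CutFreeDerivable : ∀ {V} → (Formula V → Set) → List (Formula V) → List (Formula V) → Maybe (Formula V) → Set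
CutFreeDerivable P = Der P false

-- Cut elimination via Gentzen's mix, in context-sharing form. Weakening and
-- contraction are admissible, so a derivable sequent stays derivable when its
-- antecedent and body are replaced by supersets (as sets); the mixes may therefore
-- conclude any sequent containing the premises' contexts minus the cut occurrences
-- of X, and no multiset bookkeeping is needed. Mix is proved by induction on X.
-- The stoup mix goes by induction on the first premise until it ends with a right
-- rule for X, then by induction on the second, where a left rule introducing a cut
-- occurrence of X is reduced to mixes on the immediate subformulas of X. The body
-- mix goes by induction on the first premise and invokes the stoup mix where X is
-- derelicted from the stoup.
module Submission where

open import Defs
open import Data.Empty using (⊥-elim)
open import Data.List using (List; []; _∷_; _++_; [_])
open import Data.List.Membership.Propositional using (_∈_)
open import Data.List.Membership.Propositional.Properties using (∈-++⁻; ∈-++⁺ˡ; ∈-++⁺ʳ; ∈-∃++)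
open import Data.List.Relation.Binary.Permutation.Propositional using (refl; prep; swap; ↭-sym)
open import Data.List.Relation.Binary.Permutation.Propositional.Properties using (shift; ++-comm; All-resp-↭)
open import Data.List.Relation.Binary.Subset.Propositional using (_⊆_)
open import Data.List.Relation.Binary.Subset.Propositional.Properties
  using (⊆-refl; ⊆-trans; ⊆-reflexive-↭; xs⊆xs++ys; xs⊆ys++xs; ∷⁺ʳ; ∈-∷⁺ʳ; ++⁺ʳ)
open import Data.List.Relation.Unary.All using (All; []; _∷_; head; tail)
import Data.List.Relation.Unary.All.Properties as All
open import Data.List.Relation.Unary.Any using (here; there)
open import Data.Maybe using (Maybe; just; nothing)
open import Data.Product using (_×_; _,_)
open import Data.Sum using ([_,_]′)
open import Data.Unit using (⊤; tt)
open import Function using (_∘_)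
open import Relation.Nullary using (¬_)
open import Relation.Binary.PropositionalEquality using (refl)

module _ {a} {T : Set a} where

  private variable
    x : T
    xs ys zs : List T

  []⊆ : [] ⊆ xs
  []⊆ ()

  ++⊆⁻ˡ : xs ++ ys ⊆ zs → xs ⊆ zs
  ++⊆⁻ˡ {xs = xs} {ys} s = ⊆-trans (xs⊆xs++ys xs ys) s

  ++⊆⁻ʳ : xs ++ ys ⊆ zs → ys ⊆ zs
  ++⊆⁻ʳ {xs = xs} {ys} s = ⊆-trans (xs⊆ys++xs ys xs) s

  ++⊆⁺ : xs ⊆ zs → ys ⊆ zs → xs ++ ys ⊆ zs
  ++⊆⁺ {xs = xs} s t x∈ = [ s , t ]′ (∈-++⁻ xs x∈)

  ∷⊆-absorb : x ∈ ys → xs ⊆ x ∷ ys → xs ⊆ ys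
  ∷⊆-absorb x∈ys s y∈xs with s y∈xs
  ... | here refl  = x∈ys
  ... | there y∈ys = y∈ys

  ++⁺ʳ-∷ : ∀ zs → xs ⊆ x ∷ ys → zs ++ xs ⊆ x ∷ zs ++ ys
  ++⁺ʳ-∷ []       s = s
  ++⁺ʳ-∷ (z ∷ zs) s (here refl) = there (here refl)
  ++⁺ʳ-∷ (z ∷ zs) s (there y∈) with ++⁺ʳ-∷ zs s y∈
  ... | here refl = here refl
  ... | there y∈′ = there (there y∈′)

module _ {V : Set} (P : Formula V → Set) where

  infix 3 _⊢_⨾_
  _⊢_⨾_ : List (Formula V) → List (Formula V) → Maybe (Formula V) → Set
  _⊢_⨾_ = CutFreeDerivable P

  private variable
    A B C X : Formula V
    Γ Γ' Γ₁ Γ₂ Δ Δ' Δ₁ Δ₂ Φ : List (Formula V)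
    Π : Maybe (Formula V)

  bodyᴾ : Γ ⊢ Δ ⨾ Π → All P Δ
  bodyᴾ (ex _ q d)    = All-resp-↭ q (bodyᴾ d)
  bodyᴾ ax            = []
  bodyᴾ (cut₁ () _ _)
  bodyᴾ (cut₂ () _ _)
  bodyᴾ (der p d)     = p ∷ bodyᴾ d
  bodyᴾ (cₗ d)        = bodyᴾ d
  bodyᴾ (cᵣ d)        = tail (bodyᴾ d)
  bodyᴾ (wₗ d)        = bodyᴾ d
  bodyᴾ (wᵣ p d)      = p ∷ bodyᴾ d
  bodyᴾ (zero pΔ)     = pΔ
  bodyᴾ bot           = []
  bodyᴾ (∧ₗ¹ _ _ d)   = bodyᴾ d
  bodyᴾ (∧ₗ² d)       = bodyᴾ d
  bodyᴾ (∧ᵣ¹ d e)     = All.++⁺ (bodyᴾ d) (bodyᴾ e)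
  bodyᴾ (∧ᵣ² d e)     = All.++⁺ (tail (bodyᴾ d)) (tail (bodyᴾ e))
  bodyᴾ (∧ᵣ³ d e)     = All.++⁺ (bodyᴾ d) (tail (bodyᴾ e))
  bodyᴾ (∧ᵣ⁴ d e)     = All.++⁺ (tail (bodyᴾ d)) (bodyᴾ e)
  bodyᴾ (∨ₗ¹ _ _ d _) = bodyᴾ d
  bodyᴾ (∨ₗ² d _)     = bodyᴾ d
  bodyᴾ (∨ᵣ¹ d)       = bodyᴾ d
  bodyᴾ (∨ᵣ² d)       = bodyᴾ d
  bodyᴾ (∨ᵣ³ d)       = tail (bodyᴾ d)
  bodyᴾ (∨ᵣ⁴ d)       = tail (bodyᴾ d)
  bodyᴾ (⇒ₗ¹ _ d e)   = All.++⁺ (bodyᴾ d) (bodyᴾ e)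
  bodyᴾ (⇒ₗ² d e)     = All.++⁺ (bodyᴾ d) (bodyᴾ e)
  bodyᴾ (⇒ₗ³ d e)     = All.++⁺ (bodyᴾ d) (tail (bodyᴾ e))
  bodyᴾ (⇒ᵣ¹ d)       = bodyᴾ d
  bodyᴾ (⇒ᵣ² d)       = tail (bodyᴾ d)

  headᴾ : Γ ⊢ A ∷ Δ ⨾ Π → P A
  headᴾ = head ∘ bodyᴾ

  absorbₗ : A ∈ Γ → A ∷ Γ ⊢ Δ ⨾ Π → Γ ⊢ Δ ⨾ Π
  absorbₗ {A = A} A∈Γ d with ∈-∃++ A∈Γ
  ... | Γ₁ , Γ₂ , refl =
    ex (↭-sym (shift A Γ₁ Γ₂)) refl (cₗ (ex (prep A (shift A Γ₁ Γ₂)) refl d))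

  absorbᵣ : A ∈ Δ → Γ ⊢ A ∷ Δ ⨾ Π → Γ ⊢ Δ ⨾ Π
  absorbᵣ {A = A} A∈Δ d with ∈-∃++ A∈Δ
  ... | Δ₁ , Δ₂ , refl =
    ex refl (↭-sym (shift A Δ₁ Δ₂)) (cᵣ (ex refl (prep A (shift A Δ₁ Δ₂)) d))

  wₗ-++ : ∀ Φ → Γ ⊢ Δ ⨾ Π → Φ ++ Γ ⊢ Δ ⨾ Π
  wₗ-++ []      d = d
  wₗ-++ (_ ∷ Φ) d = wₗ (wₗ-++ Φ d)

  wᵣ-++ : All P Φ → Γ ⊢ Δ ⨾ Π → Γ ⊢ Φ ++ Δ ⨾ Π
  wᵣ-++ []       d = d
  wᵣ-++ (p ∷ pΦ) d = wᵣ p (wᵣ-++ pΦ d)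

  absorbₗ-⊆ : Φ ⊆ Γ → Φ ++ Γ ⊢ Δ ⨾ Π → Γ ⊢ Δ ⨾ Π
  absorbₗ-⊆ {Φ = []}    _ d = d
  absorbₗ-⊆ {Φ = _ ∷ Φ} s d = absorbₗ-⊆ (s ∘ there) (absorbₗ (∈-++⁺ʳ Φ (s (here refl))) d)

  absorbᵣ-⊆ : Φ ⊆ Δ → Γ ⊢ Φ ++ Δ ⨾ Π → Γ ⊢ Δ ⨾ Π
  absorbᵣ-⊆ {Φ = []}    _ d = d
  absorbᵣ-⊆ {Φ = _ ∷ Φ} s d = absorbᵣ-⊆ (s ∘ there) (absorbᵣ (∈-++⁺ʳ Φ (s (here refl))) d)

  -- As ⊆ is set inclusion, this is weakening and contraction at once.
  weaken : All P Δ' → Γ ⊆ Γ' → Δ ⊆ Δ' → Γ ⊢ Δ ⨾ Π → Γ' ⊢ Δ' ⨾ Π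
  weaken {Δ' = Δ'} {Γ = Γ} {Γ' = Γ'} {Δ = Δ} pΔ' s t d =
    absorbₗ-⊆ s (absorbᵣ-⊆ t (ex (++-comm Γ' Γ) (++-comm Δ' Δ) (wₗ-++ Γ' (wᵣ-++ pΔ' d))))

  contract : Γ ++ Γ ⊢ Δ ++ Δ ⨾ Π → Γ ⊢ Δ ⨾ Π
  contract {Δ = Δ} d = weaken (All.++⁻ˡ Δ (bodyᴾ d)) (++⊆⁺ ⊆-refl ⊆-refl) (++⊆⁺ ⊆-refl ⊆-refl) d

  swapₗ : A ∷ B ∷ Γ ⊢ Δ ⨾ Π → B ∷ A ∷ Γ ⊢ Δ ⨾ Π
  swapₗ = ex (swap _ _ refl) refl

  -- The side condition of ∧ₗ¹, ∨ₗ¹, ⇒ₗ¹ on a side formula A of a left rule with stoup Π.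
  data LeftSide (A : Formula V) : Maybe (Formula V) → Set where
    empty-stoup : LeftSide A nothing
    outside-P   : ¬ P A → LeftSide A (just C)

  leftSide : ¬ P A → LeftSide A Π
  leftSide {Π = nothing} _   = empty-stoup
  leftSide {Π = just _}  ¬PA = outside-P ¬PA

  ∧ₗ⁺ : LeftSide A Π → LeftSide B Π → A ∧ B ∈ Γ → A ∷ B ∷ Γ ⊢ Δ ⨾ Π → Γ ⊢ Δ ⨾ Π
  ∧ₗ⁺ empty-stoup     empty-stoup     c d = absorbₗ c (∧ₗ² d)
  ∧ₗ⁺ (outside-P ¬PA) (outside-P ¬PB) c d = absorbₗ c (∧ₗ¹ ¬PA ¬PB d)

  ∨ₗ⁺ : LeftSide A Π → LeftSide B Π → A ∨ B ∈ Γ → A ∷ Γ ⊢ Δ ⨾ Π → B ∷ Γ ⊢ Δ ⨾ Π → Γ ⊢ Δ ⨾ Π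
  ∨ₗ⁺ empty-stoup     empty-stoup     c d e = absorbₗ c (∨ₗ² d e)
  ∨ₗ⁺ (outside-P ¬PA) (outside-P ¬PB) c d e = absorbₗ c (∨ₗ¹ ¬PA ¬PB d e)

  ⇒ₗ⁺ : LeftSide B Π → A ⇒ B ∈ Γ → B ∷ Γ ⊢ Δ ⨾ Π → Γ ⊢ Δ ⨾ just A → Γ ⊢ Δ ⨾ Π
  ⇒ₗ⁺ empty-stoup     c d e = contract (absorbₗ (∈-++⁺ˡ c) (⇒ₗ² d e))
  ⇒ₗ⁺ (outside-P ¬PB) c d e = contract (absorbₗ (∈-++⁺ˡ c) (⇒ₗ¹ ¬PB d e))

  ⇒ₗ³⁺ : A ⇒ B ∈ Γ → B ∷ Γ ⊢ Δ ⨾ nothing → Γ ⊢ A ∷ Δ ⨾ Π → Γ ⊢ Δ ⨾ Π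
  ⇒ₗ³⁺ c d e = contract (absorbₗ (∈-++⁺ˡ c) (⇒ₗ³ d e))

  -- The variants of a right rule differ only in whether each premise has its
  -- formula in the stoup or in the body.
  data Proves (Γ Δ : List (Formula V)) (A : Formula V) : Set where
    inStoup : Γ ⊢ Δ ⨾ just A → Proves Γ Δ A
    inBody  : Γ ⊢ A ∷ Δ ⨾ nothing → Proves Γ Δ A

  Proves-weaken : All P Δ' → Γ ⊆ Γ' → Δ ⊆ Δ' → Proves Γ Δ A → Proves Γ' Δ' A
  Proves-weaken pΔ' s t (inStoup d) = inStoup (weaken pΔ' s t d)
  Proves-weaken pΔ' s t (inBody d)  = inBody (weaken (headᴾ d ∷ pΔ') s (∷⁺ʳ _ t) d)

  data RightIntro (Γ Δ : List (Formula V)) : Formula V → Set where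
    ∧-intro  : Proves Γ Δ A → Proves Γ Δ B → RightIntro Γ Δ (A ∧ B)
    ∨-introˡ : Proves Γ Δ A → RightIntro Γ Δ (A ∨ B)
    ∨-introʳ : Proves Γ Δ B → RightIntro Γ Δ (A ∨ B)
    ⇒-intro  : Proves (A ∷ Γ) Δ B → RightIntro Γ Δ (A ⇒ B)

  introduce : RightIntro Γ Δ X → Γ ⊢ Δ ⨾ just X
  introduce (∧-intro (inStoup a) (inStoup b)) = contract (∧ᵣ¹ a b)
  introduce (∧-intro (inBody a)  (inBody b))  = contract (∧ᵣ² a b)
  introduce (∧-intro (inStoup a) (inBody b))  = contract (∧ᵣ³ a b)
  introduce (∧-intro (inBody a)  (inStoup b)) = contract (∧ᵣ⁴ a b)
  introduce (∨-introˡ (inStoup a)) = ∨ᵣ¹ a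
  introduce (∨-introˡ (inBody a))  = ∨ᵣ³ a
  introduce (∨-introʳ (inStoup b)) = ∨ᵣ² b
  introduce (∨-introʳ (inBody b))  = ∨ᵣ⁴ b
  introduce (⇒-intro (inStoup a))  = ⇒ᵣ¹ a
  introduce (⇒-intro (inBody a))   = ⇒ᵣ² a

  RightIntro-weaken : All P Δ' → Γ ⊆ Γ' → Δ ⊆ Δ' → RightIntro Γ Δ X → RightIntro Γ' Δ' X
  RightIntro-weaken pΔ' s t (∧-intro a b) = ∧-intro (Proves-weaken pΔ' s t a) (Proves-weaken pΔ' s t b)
  RightIntro-weaken pΔ' s t (∨-introˡ a)  = ∨-introˡ (Proves-weaken pΔ' s t a)
  RightIntro-weaken pΔ' s t (∨-introʳ b)  = ∨-introʳ (Proves-weaken pΔ' s t b)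
  RightIntro-weaken pΔ' s t (⇒-intro a)   = ⇒-intro (Proves-weaken pΔ' (∷⁺ʳ _ s) t a)

  ∧-intro⁺ : All P Δ → Γ₁ ++ Γ₂ ⊆ Γ → Δ₁ ++ Δ₂ ⊆ Δ →
             Proves Γ₁ Δ₁ A → Proves Γ₂ Δ₂ B → RightIntro Γ Δ (A ∧ B)
  ∧-intro⁺ pΔ s t a b =
    ∧-intro (Proves-weaken pΔ (++⊆⁻ˡ s) (++⊆⁻ˡ t) a) (Proves-weaken pΔ (++⊆⁻ʳ s) (++⊆⁻ʳ t) b)

  -- An inclusion into X ∷ Γ (or X ∷ Δ) marks the occurrences of X that are cut.
  Mix₁ : Formula V → Set
  Mix₁ X = ∀ {Γ Δ Π Γ₁ Δ₁ Γ₂ Δ₂} → All P Δ →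
           Γ₁ ⊢ Δ₁ ⨾ just X → Γ₁ ⊆ Γ → Δ₁ ⊆ Δ →
           Γ₂ ⊢ Δ₂ ⨾ Π → Γ₂ ⊆ X ∷ Γ → Δ₂ ⊆ Δ → Γ ⊢ Δ ⨾ Π

  Mix₂ : Formula V → Set
  Mix₂ X = ∀ {Γ Δ Π Γ₁ Δ₁ Γ₂ Δ₂} → All P Δ →
           Γ₁ ⊢ Δ₁ ⨾ Π → Γ₁ ⊆ Γ → Δ₁ ⊆ X ∷ Δ →
           Γ₂ ⊢ Δ₂ ⨾ nothing → Γ₂ ⊆ X ∷ Γ → Δ₂ ⊆ Δ → Γ ⊢ Δ ⨾ Π

  Cuts : Formula V → Set
  Cuts X = Mix₁ X × Mix₂ X

  Below : Formula V → Set
  Below (A ∧ B) = Cuts A × Cuts B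
  Below (A ∨ B) = Cuts A × Cuts B
  Below (A ⇒ B) = Cuts A × Cuts B
  Below _       = ⊤

  cut₂⁺ : Mix₂ A → All P Δ → Γ ⊢ A ∷ Δ ⨾ Π → A ∷ Γ ⊢ Δ ⨾ nothing → Γ ⊢ Δ ⨾ Π
  cut₂⁺ m₂ pΔ a r = m₂ pΔ a ⊆-refl ⊆-refl r ⊆-refl ⊆-refl

  cutˡ : Cuts A → LeftSide A Π → All P Δ → Proves Γ₁ Δ A → Γ₁ ⊆ Γ → A ∷ Γ ⊢ Δ ⨾ Π → Γ ⊢ Δ ⨾ Π
  cutˡ (m₁ , _) _               pΔ (inStoup a) s r = m₁ pΔ a s ⊆-refl r ⊆-refl ⊆-refl
  cutˡ (_ , m₂) empty-stoup     pΔ (inBody a)  s r = m₂ pΔ a s ⊆-refl r ⊆-refl ⊆-refl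
  cutˡ _        (outside-P ¬PA) _  (inBody a)  _ _ = ⊥-elim (¬PA (headᴾ a))

  Proves-cut : Mix₁ A → All P Δ → Γ ⊢ Δ ⨾ just A → Proves (A ∷ Γ) Δ B → Proves Γ Δ B
  Proves-cut m₁ pΔ a (inStoup f) = inStoup (m₁ pΔ a ⊆-refl ⊆-refl f ⊆-refl ⊆-refl)
  Proves-cut m₁ pΔ a (inBody f)  = inBody (m₁ (headᴾ f ∷ pΔ) a ⊆-refl there f ⊆-refl ⊆-refl)

  ∧-principal : Below (A ∧ B) → All P Δ → LeftSide A Π → LeftSide B Π →
                RightIntro Γ Δ (A ∧ B) → A ∷ B ∷ Γ ⊢ Δ ⨾ Π → Γ ⊢ Δ ⨾ Π
  ∧-principal (cA , cB) pΔ sA sB (∧-intro a b) r =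
    cutˡ cA sA pΔ a ⊆-refl (cutˡ cB sB pΔ b there (swapₗ r))

  ∨-principal : Below (A ∨ B) → All P Δ → LeftSide A Π → LeftSide B Π →
                RightIntro Γ Δ (A ∨ B) → A ∷ Γ ⊢ Δ ⨾ Π → B ∷ Γ ⊢ Δ ⨾ Π → Γ ⊢ Δ ⨾ Π
  ∨-principal (cA , _) pΔ sA _ (∨-introˡ a) r _ = cutˡ cA sA pΔ a ⊆-refl r
  ∨-principal (_ , cB) pΔ _ sB (∨-introʳ b) _ r = cutˡ cB sB pΔ b ⊆-refl r

  ⇒-principal : Below (A ⇒ B) → All P Δ → LeftSide B Π →
                RightIntro Γ Δ (A ⇒ B) → B ∷ Γ ⊢ Δ ⨾ Π → Γ ⊢ Δ ⨾ just A → Γ ⊢ Δ ⨾ Π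
  ⇒-principal ((m₁ , _) , cB) pΔ sB (⇒-intro f) r a = cutˡ cB sB pΔ (Proves-cut m₁ pΔ a f) ⊆-refl r

  ⇒³-principal : Below (A ⇒ B) → All P Δ →
                 RightIntro Γ Δ (A ⇒ B) → B ∷ Γ ⊢ Δ ⨾ nothing → Γ ⊢ A ∷ Δ ⨾ Π → Γ ⊢ Δ ⨾ Π
  ⇒³-principal ((_ , m₂) , cB) pΔ (⇒-intro f) r a =
    cut₂⁺ m₂ pΔ a (cutˡ cB empty-stoup pΔ f ⊆-refl (swapₗ (wₗ r)))

  mix₁-intro : Below X → All P Δ → RightIntro Γ Δ X →
               Γ₂ ⊢ Δ₂ ⨾ Π → Γ₂ ⊆ X ∷ Γ → Δ₂ ⊆ Δ → Γ ⊢ Δ ⨾ Π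

  mix₁-intro-framed : ∀ Θ Φ → Below X → All P Δ → RightIntro Γ Δ X →
                      Θ ++ Γ₂ ⊢ Φ ++ Δ₂ ⨾ Π → Γ₂ ⊆ X ∷ Γ → Δ₂ ⊆ Δ → Θ ++ Γ ⊢ Φ ++ Δ ⨾ Π

  mix₁-intro-∧ₗ : Below X → All P Δ → RightIntro Γ Δ X → LeftSide A Π → LeftSide B Π →
                  A ∷ B ∷ Γ₂ ⊢ Δ₂ ⨾ Π → A ∧ B ∷ Γ₂ ⊆ X ∷ Γ → Δ₂ ⊆ Δ → Γ ⊢ Δ ⨾ Π

  mix₁-intro-∨ₗ : Below X → All P Δ → RightIntro Γ Δ X → LeftSide A Π → LeftSide B Π →
                  A ∷ Γ₂ ⊢ Δ₂ ⨾ Π → B ∷ Γ₂ ⊢ Δ₂ ⨾ Π → A ∨ B ∷ Γ₂ ⊆ X ∷ Γ → Δ₂ ⊆ Δ → Γ ⊢ Δ ⨾ Π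

  mix₁-intro-⇒ₗ : Below X → All P Δ → RightIntro Γ Δ X → LeftSide B Π →
                  B ∷ Γ₁ ⊢ Δ₁ ⨾ Π → Γ₂ ⊢ Δ₂ ⨾ just A →
                  A ⇒ B ∷ Γ₁ ++ Γ₂ ⊆ X ∷ Γ → Δ₁ ++ Δ₂ ⊆ Δ → Γ ⊢ Δ ⨾ Π

  mix₁-intro bel pΔ ri (ex p q d) s t =
    mix₁-intro bel pΔ ri d (⊆-trans (⊆-reflexive-↭ p) s) (⊆-trans (⊆-reflexive-↭ q) t)
  mix₁-intro bel pΔ ri ax s t with s (here refl)
  ... | here refl = introduce ri
  ... | there A∈Γ = weaken pΔ (∈-∷⁺ʳ A∈Γ []⊆) []⊆ ax
  mix₁-intro bel pΔ ri (cut₁ () _ _) s t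
  mix₁-intro bel pΔ ri (cut₂ () _ _) s t
  mix₁-intro bel pΔ ri (der p d) s t =
    absorbᵣ (t (here refl)) (der p (mix₁-intro bel pΔ ri d s (t ∘ there)))
  mix₁-intro bel pΔ ri (cₗ d) s t = mix₁-intro bel pΔ ri d (∈-∷⁺ʳ (s (here refl)) s) t
  mix₁-intro bel pΔ ri (cᵣ d) s t = mix₁-intro bel pΔ ri d s (∈-∷⁺ʳ (t (here refl)) t)
  mix₁-intro bel pΔ ri (wₗ d) s t = mix₁-intro bel pΔ ri d (s ∘ there) t
  mix₁-intro bel pΔ ri (wᵣ _ d) s t = mix₁-intro bel pΔ ri d s (t ∘ there)
  mix₁-intro bel pΔ ri (zero _) s t with s (here refl)
  ... | there 𝟎∈Γ = absorbₗ 𝟎∈Γ (zero pΔ)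
  mix₁-intro bel pΔ () (zero _) s t | here refl
  mix₁-intro bel pΔ ri bot s t with s (here refl)
  ... | there ⊥∈Γ = weaken pΔ (∈-∷⁺ʳ ⊥∈Γ []⊆) []⊆ bot
  mix₁-intro bel pΔ () bot s t | here refl
  mix₁-intro bel pΔ ri (∧ₗ¹ ¬PA ¬PB d) s t =
    mix₁-intro-∧ₗ bel pΔ ri (outside-P ¬PA) (outside-P ¬PB) d s t
  mix₁-intro bel pΔ ri (∧ₗ² d) s t = mix₁-intro-∧ₗ bel pΔ ri empty-stoup empty-stoup d s t
  mix₁-intro bel pΔ ri (∧ᵣ¹ d e) s t = introduce (∧-intro
    (inStoup (mix₁-intro bel pΔ ri d (++⊆⁻ˡ s) (++⊆⁻ˡ t)))
    (inStoup (mix₁-intro bel pΔ ri e (++⊆⁻ʳ s) (++⊆⁻ʳ t))))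
  mix₁-intro bel pΔ ri (∧ᵣ² d e) s t = introduce (∧-intro
    (inBody (mix₁-intro-framed [] [ _ ] bel pΔ ri d (++⊆⁻ˡ s) (++⊆⁻ˡ t)))
    (inBody (mix₁-intro-framed [] [ _ ] bel pΔ ri e (++⊆⁻ʳ s) (++⊆⁻ʳ t))))
  mix₁-intro bel pΔ ri (∧ᵣ³ d e) s t = introduce (∧-intro
    (inStoup (mix₁-intro bel pΔ ri d (++⊆⁻ˡ s) (++⊆⁻ˡ t)))
    (inBody (mix₁-intro-framed [] [ _ ] bel pΔ ri e (++⊆⁻ʳ s) (++⊆⁻ʳ t))))
  mix₁-intro bel pΔ ri (∧ᵣ⁴ d e) s t = introduce (∧-intro
    (inBody (mix₁-intro-framed [] [ _ ] bel pΔ ri d (++⊆⁻ˡ s) (++⊆⁻ˡ t)))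
    (inStoup (mix₁-intro bel pΔ ri e (++⊆⁻ʳ s) (++⊆⁻ʳ t))))
  mix₁-intro bel pΔ ri (∨ₗ¹ ¬PA ¬PB d e) s t =
    mix₁-intro-∨ₗ bel pΔ ri (outside-P ¬PA) (outside-P ¬PB) d e s t
  mix₁-intro bel pΔ ri (∨ₗ² d e) s t = mix₁-intro-∨ₗ bel pΔ ri empty-stoup empty-stoup d e s t
  mix₁-intro bel pΔ ri (∨ᵣ¹ d) s t = ∨ᵣ¹ (mix₁-intro bel pΔ ri d s t)
  mix₁-intro bel pΔ ri (∨ᵣ² d) s t = ∨ᵣ² (mix₁-intro bel pΔ ri d s t)
  mix₁-intro bel pΔ ri (∨ᵣ³ d) s t = ∨ᵣ³ (mix₁-intro-framed [] [ _ ] bel pΔ ri d s t)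
  mix₁-intro bel pΔ ri (∨ᵣ⁴ d) s t = ∨ᵣ⁴ (mix₁-intro-framed [] [ _ ] bel pΔ ri d s t)
  mix₁-intro bel pΔ ri (⇒ₗ¹ ¬PB d e) s t = mix₁-intro-⇒ₗ bel pΔ ri (outside-P ¬PB) d e s t
  mix₁-intro bel pΔ ri (⇒ₗ² d e) s t = mix₁-intro-⇒ₗ bel pΔ ri empty-stoup d e s t
  mix₁-intro bel pΔ ri (⇒ₗ³ d e) s t with s (here refl)
    | mix₁-intro-framed [ _ ] [] bel pΔ ri d (++⊆⁻ˡ (s ∘ there)) (++⊆⁻ˡ t)
    | mix₁-intro-framed [] [ _ ] bel pΔ ri e (++⊆⁻ʳ (s ∘ there)) (++⊆⁻ʳ t)
  ... | here refl | rd | re = ⇒³-principal bel pΔ ri rd re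
  ... | there c   | rd | re = ⇒ₗ³⁺ c rd re
  mix₁-intro bel pΔ ri (⇒ᵣ¹ d) s t = ⇒ᵣ¹ (mix₁-intro-framed [ _ ] [] bel pΔ ri d s t)
  mix₁-intro bel pΔ ri (⇒ᵣ² d) s t = ⇒ᵣ² (mix₁-intro-framed [ _ ] [ _ ] bel pΔ ri d s t)

  mix₁-intro-framed {Δ = Δ} Θ Φ bel pΔ ri d s t =
    mix₁-intro bel pΦΔ (RightIntro-weaken pΦΔ (xs⊆ys++xs _ Θ) (xs⊆ys++xs _ Φ) ri)
               d (++⁺ʳ-∷ Θ s) (++⁺ʳ Φ t)
    where
    pΦΔ : All P (Φ ++ Δ)
    pΦΔ = All.++⁺ (All.++⁻ˡ Φ (bodyᴾ d)) pΔ

  mix₁-intro-∧ₗ bel pΔ ri sA sB d s t with s (here refl)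
    | mix₁-intro-framed (_ ∷ _ ∷ []) [] bel pΔ ri d (s ∘ there) t
  ... | here refl | r = ∧-principal bel pΔ sA sB ri r
  ... | there c   | r = ∧ₗ⁺ sA sB c r

  mix₁-intro-∨ₗ bel pΔ ri sA sB d e s t with s (here refl)
    | mix₁-intro-framed [ _ ] [] bel pΔ ri d (s ∘ there) t
    | mix₁-intro-framed [ _ ] [] bel pΔ ri e (s ∘ there) t
  ... | here refl | rd | re = ∨-principal bel pΔ sA sB ri rd re
  ... | there c   | rd | re = ∨ₗ⁺ sA sB c rd re

  mix₁-intro-⇒ₗ bel pΔ ri sB d e s t with s (here refl)
    | mix₁-intro-framed [ _ ] [] bel pΔ ri d (++⊆⁻ˡ (s ∘ there)) (++⊆⁻ˡ t)
    | mix₁-intro bel pΔ ri e (++⊆⁻ʳ (s ∘ there)) (++⊆⁻ʳ t)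
  ... | here refl | rd | re = ⇒-principal bel pΔ sB ri rd re
  ... | there c   | rd | re = ⇒ₗ⁺ sB c rd re

  mix₁ : Below X → Mix₁ X

  mix₁-framed : ∀ Θ Φ → Below X → All P Δ →
                Θ ++ Γ₁ ⊢ Φ ++ Δ₁ ⨾ just X → Γ₁ ⊆ Γ → Δ₁ ⊆ Δ →
                Γ₂ ⊢ Δ₂ ⨾ Π → Γ₂ ⊆ X ∷ Γ → Δ₂ ⊆ Δ → Θ ++ Γ ⊢ Φ ++ Δ ⨾ Π

  mix₁ bel pΔ (ex p q d) s₁ t₁ R s₂ t₂ =
    mix₁ bel pΔ d (⊆-trans (⊆-reflexive-↭ p) s₁) (⊆-trans (⊆-reflexive-↭ q) t₁) R s₂ t₂
  mix₁ bel pΔ ax s₁ _ R s₂ t₂ = weaken pΔ (∷⊆-absorb (s₁ (here refl)) s₂) t₂ R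
  mix₁ bel pΔ (cut₁ () _ _) s₁ t₁ R s₂ t₂
  mix₁ bel pΔ (cut₂ () _ _) s₁ t₁ R s₂ t₂
  mix₁ bel pΔ (cₗ d) s₁ t₁ R s₂ t₂ = mix₁ bel pΔ d (∈-∷⁺ʳ (s₁ (here refl)) s₁) t₁ R s₂ t₂
  mix₁ bel pΔ (cᵣ d) s₁ t₁ R s₂ t₂ = mix₁ bel pΔ d s₁ (∈-∷⁺ʳ (t₁ (here refl)) t₁) R s₂ t₂
  mix₁ bel pΔ (wₗ d) s₁ t₁ R s₂ t₂ = mix₁ bel pΔ d (s₁ ∘ there) t₁ R s₂ t₂
  mix₁ bel pΔ (wᵣ _ d) s₁ t₁ R s₂ t₂ = mix₁ bel pΔ d s₁ (t₁ ∘ there) R s₂ t₂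
  mix₁ bel pΔ (zero _) s₁ _ _ _ _ = absorbₗ (s₁ (here refl)) (zero pΔ)
  mix₁ bel pΔ (∧ₗ¹ ¬PA ¬PB d) s₁ t₁ R s₂ t₂ =
    ∧ₗ⁺ (leftSide ¬PA) (leftSide ¬PB) (s₁ (here refl))
        (mix₁-framed (_ ∷ _ ∷ []) [] bel pΔ d (s₁ ∘ there) t₁ R s₂ t₂)
  mix₁ bel pΔ (∨ₗ¹ ¬PA ¬PB d e) s₁ t₁ R s₂ t₂ =
    ∨ₗ⁺ (leftSide ¬PA) (leftSide ¬PB) (s₁ (here refl))
        (mix₁-framed [ _ ] [] bel pΔ d (s₁ ∘ there) t₁ R s₂ t₂)
        (mix₁-framed [ _ ] [] bel pΔ e (s₁ ∘ there) t₁ R s₂ t₂)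
  mix₁ bel pΔ (⇒ₗ¹ ¬PB d e) s₁ t₁ R s₂ t₂ =
    ⇒ₗ⁺ (leftSide ¬PB) (s₁ (here refl))
        (mix₁-framed [ _ ] [] bel pΔ d (++⊆⁻ˡ (s₁ ∘ there)) (++⊆⁻ˡ t₁) R s₂ t₂)
        (weaken pΔ (++⊆⁻ʳ (s₁ ∘ there)) (++⊆⁻ʳ t₁) e)
  mix₁ bel pΔ (⇒ₗ³ d e) s₁ t₁ R s₂ t₂ =
    ⇒ₗ³⁺ (s₁ (here refl))
         (weaken pΔ (∷⁺ʳ _ (++⊆⁻ˡ (s₁ ∘ there))) (++⊆⁻ˡ t₁) d)
         (mix₁-framed [] [ _ ] bel pΔ e (++⊆⁻ʳ (s₁ ∘ there)) (++⊆⁻ʳ t₁) R s₂ t₂)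
  mix₁ bel pΔ (∧ᵣ¹ a b) s₁ t₁ R s₂ t₂ =
    mix₁-intro bel pΔ (∧-intro⁺ pΔ s₁ t₁ (inStoup a) (inStoup b)) R s₂ t₂
  mix₁ bel pΔ (∧ᵣ² a b) s₁ t₁ R s₂ t₂ =
    mix₁-intro bel pΔ (∧-intro⁺ pΔ s₁ t₁ (inBody a) (inBody b)) R s₂ t₂
  mix₁ bel pΔ (∧ᵣ³ a b) s₁ t₁ R s₂ t₂ =
    mix₁-intro bel pΔ (∧-intro⁺ pΔ s₁ t₁ (inStoup a) (inBody b)) R s₂ t₂
  mix₁ bel pΔ (∧ᵣ⁴ a b) s₁ t₁ R s₂ t₂ =
    mix₁-intro bel pΔ (∧-intro⁺ pΔ s₁ t₁ (inBody a) (inStoup b)) R s₂ t₂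
  mix₁ bel pΔ (∨ᵣ¹ a) s₁ t₁ R s₂ t₂ =
    mix₁-intro bel pΔ (RightIntro-weaken pΔ s₁ t₁ (∨-introˡ (inStoup a))) R s₂ t₂
  mix₁ bel pΔ (∨ᵣ² b) s₁ t₁ R s₂ t₂ =
    mix₁-intro bel pΔ (RightIntro-weaken pΔ s₁ t₁ (∨-introʳ (inStoup b))) R s₂ t₂
  mix₁ bel pΔ (∨ᵣ³ a) s₁ t₁ R s₂ t₂ =
    mix₁-intro bel pΔ (RightIntro-weaken pΔ s₁ t₁ (∨-introˡ (inBody a))) R s₂ t₂
  mix₁ bel pΔ (∨ᵣ⁴ b) s₁ t₁ R s₂ t₂ =
    mix₁-intro bel pΔ (RightIntro-weaken pΔ s₁ t₁ (∨-introʳ (inBody b))) R s₂ t₂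
  mix₁ bel pΔ (⇒ᵣ¹ a) s₁ t₁ R s₂ t₂ =
    mix₁-intro bel pΔ (RightIntro-weaken pΔ s₁ t₁ (⇒-intro (inStoup a))) R s₂ t₂
  mix₁ bel pΔ (⇒ᵣ² a) s₁ t₁ R s₂ t₂ =
    mix₁-intro bel pΔ (RightIntro-weaken pΔ s₁ t₁ (⇒-intro (inBody a))) R s₂ t₂

  mix₁-framed {Δ = Δ} Θ Φ bel pΔ L s₁ t₁ R s₂ t₂ =
    mix₁ bel pΦΔ L (++⁺ʳ Θ s₁) (++⁺ʳ Φ t₁) R
         (⊆-trans s₂ (∷⁺ʳ _ (xs⊆ys++xs _ Θ))) (⊆-trans t₂ (xs⊆ys++xs _ Φ))
    where
    pΦΔ : All P (Φ ++ Δ)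
    pΦΔ = All.++⁺ (All.++⁻ˡ Φ (bodyᴾ L)) pΔ

  mix₂ : Mix₁ X → Mix₂ X

  mix₂-framed : ∀ Θ Φ → Mix₁ X → All P Δ →
                Θ ++ Γ₁ ⊢ Φ ++ Δ₁ ⨾ Π → Γ₁ ⊆ Γ → Δ₁ ⊆ X ∷ Δ →
                Γ₂ ⊢ Δ₂ ⨾ nothing → Γ₂ ⊆ X ∷ Γ → Δ₂ ⊆ Δ → Θ ++ Γ ⊢ Φ ++ Δ ⨾ Π

  mix₂ m pΔ (ex p q d) s₁ t₁ R s₂ t₂ =
    mix₂ m pΔ d (⊆-trans (⊆-reflexive-↭ p) s₁) (⊆-trans (⊆-reflexive-↭ q) t₁) R s₂ t₂
  mix₂ m pΔ ax s₁ _ _ _ _ = weaken pΔ (∈-∷⁺ʳ (s₁ (here refl)) []⊆) []⊆ ax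
  mix₂ m pΔ (cut₁ () _ _) s₁ t₁ R s₂ t₂
  mix₂ m pΔ (cut₂ () _ _) s₁ t₁ R s₂ t₂
  mix₂ m pΔ (der p d) s₁ t₁ R s₂ t₂ with t₁ (here refl) | mix₂ m pΔ d s₁ (t₁ ∘ there) R s₂ t₂
  ... | here refl | r = m pΔ r ⊆-refl ⊆-refl R s₂ t₂
  ... | there A∈Δ | r = absorbᵣ A∈Δ (der p r)
  mix₂ m pΔ (cₗ d) s₁ t₁ R s₂ t₂ = mix₂ m pΔ d (∈-∷⁺ʳ (s₁ (here refl)) s₁) t₁ R s₂ t₂
  mix₂ m pΔ (cᵣ d) s₁ t₁ R s₂ t₂ = mix₂ m pΔ d s₁ (∈-∷⁺ʳ (t₁ (here refl)) t₁) R s₂ t₂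
  mix₂ m pΔ (wₗ d) s₁ t₁ R s₂ t₂ = mix₂ m pΔ d (s₁ ∘ there) t₁ R s₂ t₂
  mix₂ m pΔ (wᵣ _ d) s₁ t₁ R s₂ t₂ = mix₂ m pΔ d s₁ (t₁ ∘ there) R s₂ t₂
  mix₂ m pΔ (zero _) s₁ _ _ _ _ = absorbₗ (s₁ (here refl)) (zero pΔ)
  mix₂ m pΔ bot s₁ _ _ _ _ = weaken pΔ (∈-∷⁺ʳ (s₁ (here refl)) []⊆) []⊆ bot
  mix₂ m pΔ (∧ₗ¹ ¬PA ¬PB d) s₁ t₁ R s₂ t₂ =
    ∧ₗ⁺ (outside-P ¬PA) (outside-P ¬PB) (s₁ (here refl))
        (mix₂-framed (_ ∷ _ ∷ []) [] m pΔ d (s₁ ∘ there) t₁ R s₂ t₂)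
  mix₂ m pΔ (∧ₗ² d) s₁ t₁ R s₂ t₂ =
    ∧ₗ⁺ empty-stoup empty-stoup (s₁ (here refl))
        (mix₂-framed (_ ∷ _ ∷ []) [] m pΔ d (s₁ ∘ there) t₁ R s₂ t₂)
  mix₂ m pΔ (∧ᵣ¹ d e) s₁ t₁ R s₂ t₂ = introduce (∧-intro
    (inStoup (mix₂ m pΔ d (++⊆⁻ˡ s₁) (++⊆⁻ˡ t₁) R s₂ t₂))
    (inStoup (mix₂ m pΔ e (++⊆⁻ʳ s₁) (++⊆⁻ʳ t₁) R s₂ t₂)))
  mix₂ m pΔ (∧ᵣ² d e) s₁ t₁ R s₂ t₂ = introduce (∧-intro
    (inBody (mix₂-framed [] [ _ ] m pΔ d (++⊆⁻ˡ s₁) (++⊆⁻ˡ t₁) R s₂ t₂))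
    (inBody (mix₂-framed [] [ _ ] m pΔ e (++⊆⁻ʳ s₁) (++⊆⁻ʳ t₁) R s₂ t₂)))
  mix₂ m pΔ (∧ᵣ³ d e) s₁ t₁ R s₂ t₂ = introduce (∧-intro
    (inStoup (mix₂ m pΔ d (++⊆⁻ˡ s₁) (++⊆⁻ˡ t₁) R s₂ t₂))
    (inBody (mix₂-framed [] [ _ ] m pΔ e (++⊆⁻ʳ s₁) (++⊆⁻ʳ t₁) R s₂ t₂)))
  mix₂ m pΔ (∧ᵣ⁴ d e) s₁ t₁ R s₂ t₂ = introduce (∧-intro
    (inBody (mix₂-framed [] [ _ ] m pΔ d (++⊆⁻ˡ s₁) (++⊆⁻ˡ t₁) R s₂ t₂))
    (inStoup (mix₂ m pΔ e (++⊆⁻ʳ s₁) (++⊆⁻ʳ t₁) R s₂ t₂)))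
  mix₂ m pΔ (∨ₗ¹ ¬PA ¬PB d e) s₁ t₁ R s₂ t₂ =
    ∨ₗ⁺ (outside-P ¬PA) (outside-P ¬PB) (s₁ (here refl))
        (mix₂-framed [ _ ] [] m pΔ d (s₁ ∘ there) t₁ R s₂ t₂)
        (mix₂-framed [ _ ] [] m pΔ e (s₁ ∘ there) t₁ R s₂ t₂)
  mix₂ m pΔ (∨ₗ² d e) s₁ t₁ R s₂ t₂ =
    ∨ₗ⁺ empty-stoup empty-stoup (s₁ (here refl))
        (mix₂-framed [ _ ] [] m pΔ d (s₁ ∘ there) t₁ R s₂ t₂)
        (mix₂-framed [ _ ] [] m pΔ e (s₁ ∘ there) t₁ R s₂ t₂)
  mix₂ m pΔ (∨ᵣ¹ d) s₁ t₁ R s₂ t₂ = ∨ᵣ¹ (mix₂ m pΔ d s₁ t₁ R s₂ t₂)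
  mix₂ m pΔ (∨ᵣ² d) s₁ t₁ R s₂ t₂ = ∨ᵣ² (mix₂ m pΔ d s₁ t₁ R s₂ t₂)
  mix₂ m pΔ (∨ᵣ³ d) s₁ t₁ R s₂ t₂ = ∨ᵣ³ (mix₂-framed [] [ _ ] m pΔ d s₁ t₁ R s₂ t₂)
  mix₂ m pΔ (∨ᵣ⁴ d) s₁ t₁ R s₂ t₂ = ∨ᵣ⁴ (mix₂-framed [] [ _ ] m pΔ d s₁ t₁ R s₂ t₂)
  mix₂ m pΔ (⇒ₗ¹ ¬PB d e) s₁ t₁ R s₂ t₂ =
    ⇒ₗ⁺ (outside-P ¬PB) (s₁ (here refl))
        (mix₂-framed [ _ ] [] m pΔ d (++⊆⁻ˡ (s₁ ∘ there)) (++⊆⁻ˡ t₁) R s₂ t₂)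
        (mix₂ m pΔ e (++⊆⁻ʳ (s₁ ∘ there)) (++⊆⁻ʳ t₁) R s₂ t₂)
  mix₂ m pΔ (⇒ₗ² d e) s₁ t₁ R s₂ t₂ =
    ⇒ₗ⁺ empty-stoup (s₁ (here refl))
        (mix₂-framed [ _ ] [] m pΔ d (++⊆⁻ˡ (s₁ ∘ there)) (++⊆⁻ˡ t₁) R s₂ t₂)
        (mix₂ m pΔ e (++⊆⁻ʳ (s₁ ∘ there)) (++⊆⁻ʳ t₁) R s₂ t₂)
  mix₂ m pΔ (⇒ₗ³ d e) s₁ t₁ R s₂ t₂ =
    ⇒ₗ³⁺ (s₁ (here refl))
         (mix₂-framed [ _ ] [] m pΔ d (++⊆⁻ˡ (s₁ ∘ there)) (++⊆⁻ˡ t₁) R s₂ t₂)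
         (mix₂-framed [] [ _ ] m pΔ e (++⊆⁻ʳ (s₁ ∘ there)) (++⊆⁻ʳ t₁) R s₂ t₂)
  mix₂ m pΔ (⇒ᵣ¹ d) s₁ t₁ R s₂ t₂ = ⇒ᵣ¹ (mix₂-framed [ _ ] [] m pΔ d s₁ t₁ R s₂ t₂)
  mix₂ m pΔ (⇒ᵣ² d) s₁ t₁ R s₂ t₂ = ⇒ᵣ² (mix₂-framed [ _ ] [ _ ] m pΔ d s₁ t₁ R s₂ t₂)

  mix₂-framed {Δ = Δ} Θ Φ m pΔ L s₁ t₁ R s₂ t₂ =
    mix₂ m pΦΔ L (++⁺ʳ Θ s₁) (++⁺ʳ-∷ Φ t₁) R
         (⊆-trans s₂ (∷⁺ʳ _ (xs⊆ys++xs _ Θ))) (⊆-trans t₂ (xs⊆ys++xs _ Φ))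
    where
    pΦΔ : All P (Φ ++ Δ)
    pΦΔ = All.++⁺ (All.++⁻ˡ Φ (bodyᴾ L)) pΔ

  cuts : ∀ X → Cuts X
  below : ∀ X → Below X
  cuts X = mix₁ (below X) , mix₂ (mix₁ (below X))
  below 𝟎       = tt
  below ⊥'      = tt
  below (var _) = tt
  below (A ∧ B) = cuts A , cuts B
  below (A ∨ B) = cuts A , cuts B
  below (A ⇒ B) = cuts A , cuts B

  cut₁-admissible : Γ ⊢ Δ ⨾ just A → A ∷ Γ' ⊢ Δ' ⨾ Π → Γ ++ Γ' ⊢ Δ ++ Δ' ⨾ Π
  cut₁-admissible {Γ = Γ} {Δ = Δ} {Γ' = Γ'} {Δ' = Δ'} a r =
    mix₁ (below _) (All.++⁺ (bodyᴾ a) (bodyᴾ r))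
         a (xs⊆xs++ys Γ Γ') (xs⊆xs++ys Δ Δ') r (∷⁺ʳ _ (xs⊆ys++xs Γ' Γ)) (xs⊆ys++xs Δ' Δ)

  cut₂-admissible : Γ ⊢ A ∷ Δ ⨾ Π → A ∷ Γ' ⊢ Δ' ⨾ nothing → Γ ++ Γ' ⊢ Δ ++ Δ' ⨾ Π
  cut₂-admissible {Γ = Γ} {Δ = Δ} {Γ' = Γ'} {Δ' = Δ'} a r =
    mix₂ (mix₁ (below _)) (All.++⁺ (tail (bodyᴾ a)) (bodyᴾ r))
         a (xs⊆xs++ys Γ Γ') (∷⁺ʳ _ (xs⊆xs++ys Δ Δ')) r (∷⁺ʳ _ (xs⊆ys++xs Γ' Γ)) (xs⊆ys++xs Δ' Δ)

  cut-elimination : Derivable P Γ Δ Π → Γ ⊢ Δ ⨾ Π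
  cut-elimination (ex p q d)      = ex p q (cut-elimination d)
  cut-elimination ax              = ax
  cut-elimination (cut₁ _ d e)    = cut₁-admissible (cut-elimination d) (cut-elimination e)
  cut-elimination (cut₂ _ d e)    = cut₂-admissible (cut-elimination d) (cut-elimination e)
  cut-elimination (der p d)       = der p (cut-elimination d)
  cut-elimination (cₗ d)          = cₗ (cut-elimination d)
  cut-elimination (cᵣ d)          = cᵣ (cut-elimination d)
  cut-elimination (wₗ d)          = wₗ (cut-elimination d)
  cut-elimination (wᵣ p d)        = wᵣ p (cut-elimination d)
  cut-elimination (zero pΔ)       = zero pΔ
  cut-elimination bot             = bot
  cut-elimination (∧ₗ¹ ¬PA ¬PB d) = ∧ₗ¹ ¬PA ¬PB (cut-elimination d)
  cut-elimination (∧ₗ² d)         = ∧ₗ² (cut-elimination d)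
  cut-elimination (∧ᵣ¹ d e)       = ∧ᵣ¹ (cut-elimination d) (cut-elimination e)
  cut-elimination (∧ᵣ² d e)       = ∧ᵣ² (cut-elimination d) (cut-elimination e)
  cut-elimination (∧ᵣ³ d e)       = ∧ᵣ³ (cut-elimination d) (cut-elimination e)
  cut-elimination (∧ᵣ⁴ d e)       = ∧ᵣ⁴ (cut-elimination d) (cut-elimination e)
  cut-elimination (∨ₗ¹ ¬PA ¬PB d e) = ∨ₗ¹ ¬PA ¬PB (cut-elimination d) (cut-elimination e)
  cut-elimination (∨ₗ² d e)       = ∨ₗ² (cut-elimination d) (cut-elimination e)
  cut-elimination (∨ᵣ¹ d)         = ∨ᵣ¹ (cut-elimination d)
  cut-elimination (∨ᵣ² d)         = ∨ᵣ² (cut-elimination d)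
  cut-elimination (∨ᵣ³ d)         = ∨ᵣ³ (cut-elimination d)
  cut-elimination (∨ᵣ⁴ d)         = ∨ᵣ⁴ (cut-elimination d)
  cut-elimination (⇒ₗ¹ ¬PB d e)   = ⇒ₗ¹ ¬PB (cut-elimination d) (cut-elimination e)
  cut-elimination (⇒ₗ² d e)       = ⇒ₗ² (cut-elimination d) (cut-elimination e)
  cut-elimination (⇒ₗ³ d e)       = ⇒ₗ³ (cut-elimination d) (cut-elimination e)
  cut-elimination (⇒ᵣ¹ d)         = ⇒ᵣ¹ (cut-elimination d)
  cut-elimination (⇒ᵣ² d)         = ⇒ᵣ² (cut-elimination d)

theorem3p1 : (V : Set) (P : Formula V → Set)
             (Γ Δ : List (Formula V)) (Π : Maybe (Formula V)) →
             All P Δ →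
             Derivable P Γ Δ Π → CutFreeDerivable P Γ Δ Π
theorem3p1 V P Γ Δ Π _ = cut-elimination P
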